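{- Let $L$ be a Fomin lattice with a minimum element $\hat{0}$, differential degree $r$ and weighting $w$, suppose $L$ is not the one-element lattice, the value set is $V=\mathbb{Z}$, and all values of $w$ are positive. Then $r>0$.
   Context: A Fomin lattice consists of: a lattice $L$ that is modular, locally finite, and in which every element has finitely many upper covers and finitely many lower covers; a module $V$ (the set of values) over a unital ring; an element $r\in V$ (the differential degree); and a function $w$ assigning to every covering $x\lessdot y$ of $L$ a value in $V$, such that (a) for all $x\in L$, $\sum_{y\lessdot x} w(y\lessdot x)+r=\sum_{x\lessdot z}w(x\lessdot z)$, and (b) $w$ is projective-constant: whenever $x\vee y$ covers both $x$ and $y$ and $x\wedge y$ is covered by both, then $w(x\wedge y\lessdot x)=w(y\lessdot x\vee y)$ and $w(x\wedge y\lessdot y)=w(x\lessdot x\vee y)$. -}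

module Defs where

open import Level using (Level; _⊔_; suc)
open import Data.Integer using (ℤ; _+_; 0ℤ)
open import Data.List using (List; foldr; map)
open import Data.List.Membership.Propositional using (_∈_)
open import Data.List.Relation.Unary.Unique.Propositional using (Unique)
open import Data.Product using (_×_; Σ; ∃)
open import Function.Bundles using (_⇔_)
open import Relation.Binary.PropositionalEquality using (_≡_; _≢_)
open import Relation.Binary.Lattice.Structures using (IsLattice)
open import Relation.Nullary using (¬_)

sumℤ : List ℤ → ℤ
sumℤ = foldr _+_ 0ℤ

module _ {a ℓ : Level} {A : Set a} (_≤_ : A → A → Set ℓ) where
  _<ₚ_ : A → A → Set (a ⊔ ℓ)
  x <ₚ y = (x ≤ y) × (x ≢ y)

  Covers : A → A → Set (a ⊔ ℓ)
  Covers x y = (x <ₚ y) × ¬ (Σ A λ z → (x <ₚ z) × (z <ₚ y))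

-- A Fomin lattice with value set V = ℤ (regarded as a ℤ-module),
-- differential degree r and weighting w.
-- "finitely many upper/lower covers" is witnessed by duplicate-free lists
-- enumerating exactly the upper/lower covers of each element; the sums in
-- condition (a) are taken over these enumerations.
-- The weighting w is a function on pairs; only its values on coverings x ⋖ y
-- are ever used.
record FominLatticeℤ (a ℓ : Level) : Set (suc (a ⊔ ℓ)) where
  field
    Carrier   : Set a
    _≤_       : Carrier → Carrier → Set ℓ
    _∨_       : Carrier → Carrier → Carrier
    _∧_       : Carrier → Carrier → Carrier
    isLattice : IsLattice _≡_ _≤_ _∨_ _∧_

  _⋖_ : Carrier → Carrier → Set (a ⊔ ℓ)
  _⋖_ = Covers _≤_

  field
    modular : ∀ x y z → x ≤ z → (x ∨ (y ∧ z)) ≡ ((x ∨ y) ∧ z)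
    locallyFinite : ∀ x y → ∃ λ (l : List Carrier) →
                      ∀ z → ((x ≤ z) × (z ≤ y)) ⇔ (z ∈ l)
    upCovers        : Carrier → List Carrier
    upCovers-unique : ∀ x → Unique (upCovers x)
    upCovers-exact  : ∀ x z → (x ⋖ z) ⇔ (z ∈ upCovers x)
    lowCovers        : Carrier → List Carrier
    lowCovers-unique : ∀ x → Unique (lowCovers x)
    lowCovers-exact  : ∀ x y → (y ⋖ x) ⇔ (y ∈ lowCovers x)
    r : ℤ
    w : Carrier → Carrier → ℤ
    differential : ∀ x →
      (sumℤ (map (λ y → w y x) (lowCovers x)) + r)
        ≡ sumℤ (map (λ z → w x z) (upCovers x))
    projConst : ∀ x y →
      (x ∧ y) ⋖ x → (x ∧ y) ⋖ y → x ⋖ (x ∨ y) → y ⋖ (x ∨ y) →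
      (w (x ∧ y) x ≡ w y (x ∨ y)) × (w (x ∧ y) y ≡ w x (x ∨ y))

-- At the minimum 0̂ there are no lower covers, so condition (a) says that r is the
-- total weight of the upper covers of 0̂. Any element other than 0̂ lies above 0̂,
-- and a descending walk inside the finite interval [0̂, c] must reach an atom, i.e.
-- an upper cover of 0̂. Its weight is positive, hence so is r.
module Submission where

open import Defs
open import Level using (Level; _⊔_)
open import Data.Integer using (ℤ; _<_; 0ℤ; _+_) renaming (_≤_ to _≤ℤ_)
open import Data.Integer.Properties as ℤ using ()
open import Data.Nat using (zero; suc)
open import Data.Nat.Properties using (suc-injective)
open import Data.List using (List; []; _∷_; map; length)
open import Data.List.Properties using (length-removeAt′)
open import Data.List.Relation.Unary.Any using (here; there; _─_)
open import Data.List.Membership.Propositional using (_∈_; _∉_)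
open import Data.Product using (Σ; ∃; _,_; proj₁; proj₂)
open import Function.Bundles using (Equivalence)
open import Relation.Binary.Structures using (IsPartialOrder)
open import Relation.Binary.Lattice.Structures using (IsLattice)
open import Relation.Binary.PropositionalEquality using (_≡_; _≢_; refl; sym; trans; subst; module ≡-Reasoning)
open import Relation.Nullary using (¬_)
open import Relation.Nullary.Decidable using (decidable-stable)

module _ {a : Level} {A : Set a} where

  ∈-─ : ∀ {xs : List A} {d y} (d∈xs : d ∈ xs) → y ∈ xs → y ≢ d → y ∈ (xs ─ d∈xs)
  ∈-─ (here refl) (here refl)  y≢d with () ← y≢d refl
  ∈-─ (here refl) (there y∈xs) _   = y∈xs
  ∈-─ (there _)   (here refl)  _   = here refl
  ∈-─ (there d∈xs) (there y∈xs) y≢d = there (∈-─ d∈xs y∈xs y≢d)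

  ∉-all⇒≡[] : (xs : List A) → (∀ y → y ∉ xs) → xs ≡ []
  ∉-all⇒≡[] []       _ = refl
  ∉-all⇒≡[] (x ∷ xs) h with () ← h x (here refl)

  sumℤ-map-nonneg : (f : A → ℤ) (xs : List A) →
                    (∀ y → y ∈ xs → 0ℤ < f y) → 0ℤ ≤ℤ sumℤ (map f xs)
  sumℤ-map-nonneg f []       _   = ℤ.≤-refl
  sumℤ-map-nonneg f (x ∷ xs) pos =
    ℤ.+-mono-≤ (ℤ.<⇒≤ (pos x (here refl))) (sumℤ-map-nonneg f xs (λ y p → pos y (there p)))

  sumℤ-map-pos : (f : A → ℤ) (xs : List A) {c : A} → c ∈ xs →
                 (∀ y → y ∈ xs → 0ℤ < f y) → 0ℤ < sumℤ (map f xs)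
  sumℤ-map-pos f (x ∷ xs) (here refl) pos =
    ℤ.+-mono-<-≤ (pos x (here refl)) (sumℤ-map-nonneg f xs (λ y p → pos y (there p)))
  sumℤ-map-pos f (x ∷ xs) (there c∈xs) pos =
    ℤ.+-mono-≤-< (ℤ.<⇒≤ (pos x (here refl))) (sumℤ-map-pos f xs c∈xs (λ y p → pos y (there p)))

module _ {a ℓ : Level} {A : Set a} {_≤_ : A → A → Set ℓ}
         (isPartialOrder : IsPartialOrder _≡_ _≤_) where

  open IsPartialOrder isPartialOrder using (antisym) renaming (trans to ≤-trans)

  private
    _⊏_ : A → A → Set (a ⊔ ℓ)
    _⊏_ = _<ₚ_ _≤_
    _⋖_ : A → A → Set (a ⊔ ℓ)
    _⋖_ = Covers _≤_

  ⊏-trans : ∀ {x y z} → x ⊏ y → y ⊏ z → x ⊏ z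
  ⊏-trans (x≤y , _) (y≤z , y≢z) = ≤-trans x≤y y≤z , λ { refl → y≢z (antisym y≤z x≤y) }

  -- Induction on the number of points of the open interval (x, c): a point d
  -- strictly between x and c has strictly fewer points in (x, d), since d itself
  -- is dropped.
  ¬¬∃-cover-below : ∀ n {x c} → x ⊏ c → (xs : List A) → length xs ≡ n →
                    (∀ d → x ⊏ d → d ⊏ c → d ∈ xs) → ¬ ¬ ∃ (x ⋖_)
  ¬¬∃-cover-below zero {x} {c} x⊏c [] _ enum noCover =
    noCover (c , x⊏c , λ { (d , x⊏d , d⊏c) → empty (enum d x⊏d d⊏c) })
    where empty : ∀ {d} → d ∉ []
          empty ()
  ¬¬∃-cover-below (suc n) {x} {c} x⊏c xs |xs| enum noCover =
    noCover (c , x⊏c , λ { (d , x⊏d , d⊏c) → below d x⊏d d⊏c noCover })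
    where
    below : ∀ d → x ⊏ d → d ⊏ c → ¬ ¬ ∃ (x ⋖_)
    below d x⊏d d⊏c =
      ¬¬∃-cover-below n x⊏d (xs ─ d∈xs)
        (suc-injective (trans (sym (length-removeAt′ xs _)) |xs|))
        (λ e x⊏e e⊏d → ∈-─ d∈xs (enum e x⊏e (⊏-trans e⊏d d⊏c)) (proj₂ e⊏d))
      where d∈xs = enum d x⊏d d⊏c

module _ {a ℓ : Level} (L : FominLatticeℤ a ℓ) where

  open FominLatticeℤ L
  open IsLattice isLattice using (isPartialOrder; antisym)
  open Equivalence

  module _ {bot : Carrier} (bot-min : ∀ x → bot ≤ x) where

    lowCovers-bot : lowCovers bot ≡ []
    lowCovers-bot = ∉-all⇒≡[] (lowCovers bot) λ y y∈ →
      let ((y≤bot , y≢bot) , _) = from (lowCovers-exact bot y) y∈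
      in y≢bot (antisym y≤bot (bot-min y))

    r≡weight-of-atoms : r ≡ sumℤ (map (w bot) (upCovers bot))
    r≡weight-of-atoms = begin
      r                                       ≡⟨ sym (ℤ.+-identityˡ r) ⟩
      sumℤ (map (λ y → w y bot) []) + r       ≡⟨ subst (λ ys → sumℤ (map (λ y → w y bot) ys) + r ≡ _)
                                                       lowCovers-bot (differential bot) ⟩
      sumℤ (map (w bot) (upCovers bot))       ∎
      where open ≡-Reasoning

    atom⇒0<r : (∀ x y → x ⋖ y → 0ℤ < w x y) → ∀ {c} → bot ⋖ c → 0ℤ < r
    atom⇒0<r w-pos bot⋖c =
      subst (0ℤ <_) (sym r≡weight-of-atoms)
        (sumℤ-map-pos (w bot) (upCovers bot) (to (upCovers-exact bot _) bot⋖c)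
          (λ z z∈ → w-pos bot z (from (upCovers-exact bot z) z∈)))

    ¬¬∃-atom : ∀ {c} → c ≢ bot → ¬ ¬ ∃ (bot ⋖_)
    ¬¬∃-atom {c} c≢bot with interval , enum ← locallyFinite bot c =
      ¬¬∃-cover-below isPartialOrder (length interval) (bot-min c , λ bot≡c → c≢bot (sym bot≡c))
        interval refl (λ d bot<d d<c → to (enum d) (proj₁ bot<d , proj₁ d<c))

    ¬0<r⇒¬≢bot : (∀ x y → x ⋖ y → 0ℤ < w x y) → ¬ 0ℤ < r → ∀ c → ¬ c ≢ bot
    ¬0<r⇒¬≢bot w-pos r≯0 c c≢bot =
      ¬¬∃-atom c≢bot λ (_ , bot⋖c) → r≯0 (atom⇒0<r w-pos bot⋖c)

lemma2p7 : {a ℓ : Level} (L : FominLatticeℤ a ℓ) →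
    let open FominLatticeℤ L in
    (Σ Carrier λ bot → ∀ x → bot ≤ x) →
    (Σ Carrier λ x → Σ Carrier λ y → x ≢ y) →
    (∀ x y → x ⋖ y → 0ℤ < w x y) →
    0ℤ < r
lemma2p7 L (bot , bot-min) (x , y , x≢y) w-pos =
  decidable-stable (0ℤ ℤ.<? FominLatticeℤ.r L) λ r≯0 →
    let ¬≢bot = ¬0<r⇒¬≢bot L bot-min w-pos r≯0
    in ¬≢bot x λ x≡bot → ¬≢bot y λ y≡bot → x≢y (trans x≡bot (sym y≡bot))
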